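{- For every integer $n\ge 4$, the disjunctive domination number of the torus grid graph $C_4\Box C_n$ is $$\gamma_2^d(C_4\Box C_n)=\begin{cases}\dfrac{n}{2}+1, & n\equiv 2\pmod 4,\\[2mm] \left\lceil\dfrac{n}{2}\right\rceil, & \text{otherwise.}\end{cases}$$
   Context: $C_k$ denotes the cycle on $k$ vertices. For graphs $G,H$, the Cartesian product $G\Box H$ has vertex set $V(G)\times V(H)$, with $(g,h)$ adjacent to $(g',h')$ iff either $g=g'$ and $hh'\in E(H)$, or $h=h'$ and $gg'\in E(G)$. For a graph $\Gamma$ and a vertex $v$, let $\Gamma(v)$ be the set of vertices at distance exactly $1$ from $v$ and $\Gamma_2(v)$ the set of vertices at distance exactly $2$ from $v$. A set $S\subseteq V(\Gamma)$ is a disjunctive dominating set if every vertex $v\notin S$ satisfies $|\Gamma(v)\cap S|\ge 1$ or $|\Gamma_2(v)\cap S|\ge 2$. The disjunctive domination number $\gamma_2^d(\Gamma)$ is the minimum cardinality of a disjunctive dominating set of $\Gamma$. -}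

module Defs where

open import Level using (0ℓ)
open import Data.Nat using (ℕ; zero; suc; _+_; _≤_; _∸_; _%_; _/_; ⌈_/2⌉; _≡ᵇ_)
open import Data.Bool using (if_then_else_)
open import Data.Fin using (Fin; toℕ)
open import Data.Product using (_×_; Σ; ∃; ∃-syntax; _,_)
open import Data.Sum using (_⊎_)
open import Data.List using (List; length)
open import Data.List.Membership.Propositional using (_∈_; _∉_)
open import Data.List.Relation.Unary.Unique.Propositional using (Unique)
open import Relation.Binary.PropositionalEquality using (_≡_)
open import Relation.Nullary using (¬_)

record Graph : Set₁ where
  field
    V   : Set
    Adj : V → V → Set
open Graph public

Next : (k : ℕ) → Fin k → Fin k → Set
Next k i j = (toℕ j ≡ suc (toℕ i)) ⊎ ((suc (toℕ i) ≡ k) × (toℕ j ≡ 0))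

Cycle : ℕ → Graph
Cycle k = record { V = Fin k ; Adj = λ i j → Next k i j ⊎ Next k j i }

_□_ : Graph → Graph → Graph
G □ H = record
  { V   = V G × V H
  ; Adj = λ { (g , h) (g' , h') →
              ((g ≡ g') × Adj H h h') ⊎ ((h ≡ h') × Adj G g g') } }

data Walk (G : Graph) : V G → V G → ℕ → Set where
  [] : ∀ {u} → Walk G u u 0
  _∷_ : ∀ {u w v m} → Adj G u w → Walk G w v m → Walk G u v (suc m)

DistLE : (G : Graph) → ℕ → V G → V G → Set
DistLE G k u v = ∃[ m ] (m ≤ k × Walk G u v m)

DistEq : (G : Graph) → ℕ → V G → V G → Set
DistEq G zero    u v = DistLE G 0 u v
DistEq G (suc k) u v = DistLE G (suc k) u v × ¬ DistLE G k u v

IsDisjDom : (G : Graph) → List (V G) → Set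
IsDisjDom G S = ∀ v → v ∉ S →
    (∃[ s ] (s ∈ S × DistEq G 1 v s))
  ⊎ (∃[ s ] ∃[ t ] (s ∈ S × t ∈ S × ¬ s ≡ t × DistEq G 2 v s × DistEq G 2 v t))

DisjDomNumberIs : Graph → ℕ → Set
DisjDomNumberIs G k =
    (∃[ S ] (Unique S × IsDisjDom G S × length S ≡ k))
  × (∀ S → Unique S → IsDisjDom G S → k ≤ length S)

target : ℕ → ℕ
target n = if (n % 4) ≡ᵇ 2 then n / 2 + 1 else ⌈ n /2⌉

-- Cut the torus C₄ □ Cₙ into its n columns, each a copy of C₄, and read a vertex set as the
-- n-periodic sequence of its columns. Whether a vertex of column x + 2 is disjunctively dominated
-- depends only on the five columns x, …, x + 4. Checking the 16 ways of placing at most one vertex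
-- in four consecutive columns shows that two consecutive dominated windows force at least two
-- vertices into their four common columns; summing over the n positions gives 4 |S| ≥ 2 n.
-- If n = 4q + 2 and 4 |S| = 2 n, every four consecutive columns hold exactly two vertices, so the
-- columns alternate between one vertex and none, consecutive occupied columns use antipodal rows,
-- and going once around the torus takes the odd number 2q + 1 of such steps: a contradiction.
-- Conversely the columns {0}, ∅, {2}, ∅ repeated, followed by a tail depending on n mod 4, give a
-- set of the required size; its finitely many kinds of windows are checked by evaluation, and
-- n = 4 is decided outright.
module Submission where

open import Defs

open import Data.Bool using (Bool; true; if_then_else_; _∧_; T)
open import Data.Bool.Properties using (T-∧)
open import Data.Empty using () renaming (⊥ to Empty; ⊥-elim to absurd)
open import Data.Fin as Fin using (Fin; zero; suc; toℕ; fromℕ<; #_)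
open import Data.Fin.Properties using (toℕ-injective; toℕ<n; toℕ-fromℕ<; any?; all?)
open import Data.Fin.Subset
  using (Subset; inside; outside; ⊥; ⊤; ⁅_⁆; _∪_; _-_; ∣_∣; Nonempty)
  renaming (_∈_ to _∈ₛ_; _⊆_ to _⊆ₛ_)
open import Data.Fin.Subset.Properties
  using (⊆⊤; ⊆-reflexive; ∉⊥; x∈⁅x⁆; x∈⁅y⁆⇒x≡y; ∣⁅x⁆∣≡1; ∣⊥∣≡0; ∣p∣≤∣x∷p∣;
         x∈p⇒∣p-x∣<∣p∣; x∈p∧x≢y⇒x∈p-y; x∈p∪q⁺; nonempty?; Empty-unique)
  renaming (_∈?_ to _∈ₛ?_)
open import Data.List using (List; []; _∷_; length; _++_; take; map; catMaybes; cartesianProduct; allFin)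
open import Data.List.Properties using (length-map; length-++; length-take)
open import Data.List.Membership.Propositional using (_∈_; _∉_; find; lose)
open import Data.List.Membership.Propositional.Properties using (∈-cartesianProduct⁺; ∈-allFin)
import Data.List.Membership.DecPropositional as Membership
open import Data.List.Relation.Unary.Any using (here; there)
import Data.List.Relation.Unary.Any as Any
import Data.List.Relation.Unary.All as All
open import Data.List.Relation.Unary.AllPairs using ([]; _∷_)
open import Data.List.Relation.Unary.Unique.Propositional using (Unique)
import Data.List.Relation.Unary.Unique.DecPropositional as UniqueDec
open import Data.Maybe using (Maybe; just; nothing)
open import Data.Nat as ℕ
  using (ℕ; zero; suc; _+_; _*_; _∸_; _≤_; _<_; z≤n; s≤s; s≤s⁻¹; NonZero; pred; _%_; _/_; _<?_; _≡ᵇ_;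
         ⌊_/2⌋; ⌈_/2⌉)
open import Data.Nat.DivMod
open import Data.Nat.Properties
open import Algebra.Properties.CommutativeSemigroup +-commutativeSemigroup using (interchange; x∙yz≈y∙xz)
open import Data.Nat.Solver using (module +-*-Solver)
open +-*-Solver using (solve; _:+_; _:*_; _:=_; con)
open import Data.Product using (∃₂; ∃-syntax; _×_; _,_; proj₁; proj₂)
open import Data.Product.Properties using (≡-dec)
open import Data.Sum using (_⊎_; inj₁; inj₂; [_,_]′)
open import Data.Unit using (tt)
open import Data.Vec using ([]; _∷_; lookup)
open import Function using (_∘_)
open import Function.Bundles using (Equivalence)
open import Relation.Nullary using (¬_; Dec; yes; no; does; isYes)
open import Relation.Nullary.Decidable using (_×-dec_; _⊎-dec_; ¬?; _→-dec_; from-yes; toWitness; map′)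
open import Relation.Binary.PropositionalEquality
  using (_≡_; _≢_; refl; sym; trans; cong; cong₂; subst; module ≡-Reasoning)

walk-zero : ∀ {G u v} → Walk G u v 0 → u ≡ v
walk-zero [] = refl

∈∉⇒≢ : ∀ {A : Set} {S : List A} {u v} → v ∈ S → u ∉ S → u ≢ v
∈∉⇒≢ v∈ u∉ refl = u∉ v∈

¬DistLE-0 : ∀ {G u v} → u ≢ v → ¬ DistLE G 0 u v
¬DistLE-0 u≢v (zero , _ , walk) = u≢v (walk-zero walk)

module FiniteGraph (G : Graph) (_≟_ : (u v : V G) → Dec (u ≡ v)) (adjacent? : ∀ u v → Dec (Adj G u v))
                   (vertices : List (V G)) (complete : ∀ v → v ∈ vertices) where

  open Membership _≟_ using (_∈?_)

  ∃∈? : ∀ {P : V G → Set} xs → (∀ v → Dec (P v)) → Dec (∃[ v ] (v ∈ xs × P v))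
  ∃∈? xs P? = map′ find (λ (_ , v∈ , pv) → lose v∈ pv) (Any.any? P? xs)

  walk? : ∀ u v m → Dec (Walk G u v m)
  walk? u v zero = map′ (λ { refl → [] }) walk-zero (u ≟ v)
  walk? u v (suc m) = map′ (λ (_ , _ , u~w , walk) → u~w ∷ walk)
                           (λ { (_∷_ {w = w} u~w walk) → w , complete w , u~w , walk })
                           (∃∈? vertices λ w → adjacent? u w ×-dec walk? w v m)

  distLE? : ∀ k u v → Dec (DistLE G k u v)
  distLE? k u v = map′ (λ (m , m<1+k , walk) → m , s≤s⁻¹ m<1+k , walk)
                       (λ (m , m≤k , walk) → m , s≤s m≤k , walk)
                       (anyUpTo? (walk? u v) (suc k))

  distEq? : ∀ k u v → Dec (DistEq G k u v)
  distEq? zero u v = distLE? 0 u v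
  distEq? (suc k) u v = distLE? (suc k) u v ×-dec ¬? (distLE? k u v)

  isDisjDom? : ∀ S → Dec (IsDisjDom G S)
  isDisjDom? S = map′ (λ all v → All.lookup all (complete v)) (λ dds → All.tabulate λ {v} _ → dds v)
    (All.all? (λ v → ¬? (v ∈? S) →-dec (one? v ⊎-dec two? v)) vertices)
    where
    one? : ∀ v → Dec (∃[ s ] (s ∈ S × DistEq G 1 v s))
    one? v = ∃∈? S (distEq? 1 v)
    two? : ∀ v → Dec (∃[ s ] ∃[ t ] (s ∈ S × t ∈ S × ¬ s ≡ t × DistEq G 2 v s × DistEq G 2 v t))
    two? v = map′ (λ (s , s∈ , t , t∈ , rest) → s , t , s∈ , t∈ , rest)
                  (λ (s , t , s∈ , t∈ , rest) → s , s∈ , t , t∈ , rest)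
                  (∃∈? S λ s → ∃∈? S λ t → ¬? (s ≟ t) ×-dec distEq? 2 v s ×-dec distEq? 2 v t)

next? : ∀ k (i j : Fin k) → Dec (Next k i j)
next? k i j = (toℕ j ℕ.≟ suc (toℕ i)) ⊎-dec ((suc (toℕ i) ℕ.≟ k) ×-dec (toℕ j ℕ.≟ 0))

cycle-adjacent? : ∀ k (i j : Fin k) → Dec (Adj (Cycle k) i j)
cycle-adjacent? k i j = next? k i j ⊎-dec next? k j i

Next-functional : ∀ {k} {i j j′ : Fin k} → Next k i j → Next k i j′ → j ≡ j′
Next-functional (inj₁ j≡) (inj₁ j′≡) = toℕ-injective (trans j≡ (sym j′≡))
Next-functional {j = j} (inj₁ j≡) (inj₂ (last , _)) = absurd (<-irrefl (trans j≡ last) (toℕ<n j))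
Next-functional {j′ = j′} (inj₂ (last , _)) (inj₁ j′≡) = absurd (<-irrefl (trans j′≡ last) (toℕ<n j′))
Next-functional (inj₂ (_ , j≡0)) (inj₂ (_ , j′≡0)) = toℕ-injective (trans j≡0 (sym j′≡0))

Next-injective : ∀ {k} {i i′ j : Fin k} → Next k i j → Next k i′ j → i ≡ i′
Next-injective (inj₁ j≡) (inj₁ j≡′) = toℕ-injective (suc-injective (trans (sym j≡) j≡′))
Next-injective (inj₁ j≡) (inj₂ (_ , j≡0)) = absurd (0≢1+n (trans (sym j≡0) j≡))
Next-injective (inj₂ (_ , j≡0)) (inj₁ j≡) = absurd (0≢1+n (trans (sym j≡0) j≡))
Next-injective (inj₂ (last , _)) (inj₂ (last′ , _)) = toℕ-injective (suc-injective (trans last (sym last′)))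

module Wrap (n : ℕ) {{_ : NonZero n}} where

  wrap : ℕ → Fin n
  wrap y = fromℕ< (m%n<n y n)

  toℕ-wrap : ∀ y → toℕ (wrap y) ≡ y % n
  toℕ-wrap y = toℕ-fromℕ< (m%n<n y n)

  wrap-≡ : ∀ {y z} → y % n ≡ z % n → wrap y ≡ wrap z
  wrap-≡ {y} {z} eq = toℕ-injective (trans (toℕ-wrap y) (trans eq (sym (toℕ-wrap z))))

  wrap-periodic : ∀ y → wrap (n + y) ≡ wrap y
  wrap-periodic y = wrap-≡ (trans (%-congˡ (+-comm n y)) ([m+n]%n≡m%n y n))

  wrap-% : ∀ y → wrap (y % n) ≡ wrap y
  wrap-% y = wrap-≡ (m%n%n≡m%n y n)

  wrap-+% : ∀ a y → wrap (a + y % n) ≡ wrap (a + y)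
  wrap-+% a y = wrap-≡ (begin
    (a + y % n) % n            ≡⟨ %-distribˡ-+ a (y % n) n ⟩
    (a % n + y % n % n) % n    ≡⟨ cong (λ m → (a % n + m) % n) (m%n%n≡m%n y n) ⟩
    (a % n + y % n) % n        ≡⟨ %-distribˡ-+ a y n ⟨
    (a + y) % n                ∎)
    where open ≡-Reasoning

  wrap-toℕ : ∀ c → wrap (toℕ c) ≡ c
  wrap-toℕ c = toℕ-injective (trans (toℕ-wrap (toℕ c)) (m<n⇒m%n≡m (toℕ<n c)))

  suc-% : ∀ y → suc y % n ≡ suc (y % n) % n
  suc-% y = trans (%-congˡ (cong suc (m≡m%n+[m/n]*n y n))) ([m+kn]%n≡m%n (suc (y % n)) (y / n) n)

  wrap-Next : ∀ y → Next n (wrap y) (wrap (suc y))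
  wrap-Next y rewrite toℕ-wrap y | toℕ-wrap (suc y) | suc-% y with suc (y % n) <? n
  ... | yes below = inj₁ (m<n⇒m%n≡m below)
  ... | no ¬below = inj₂ (last , trans (%-congˡ last) (n%n≡0 n))
    where last = ≤-antisym (m%n<n y n) (≮⇒≥ ¬below)

  wrap-adjacent : ∀ y {c} → Adj (Cycle n) (wrap (suc y)) c → c ≡ wrap (suc (suc y)) ⊎ c ≡ wrap y
  wrap-adjacent y (inj₁ next) = inj₁ (Next-functional next (wrap-Next (suc y)))
  wrap-adjacent y (inj₂ prev) = inj₂ (Next-injective prev (wrap-Next y))

  -- adding x * pred n turns i + x into i + x * n
  %-cancelʳ-+ : ∀ i j x → (i + x) % n ≡ (j + x) % n → i % n ≡ j % n
  %-cancelʳ-+ i j x eq = trans (unshift i) (trans (cong (λ m → (m + k % n) % n) eq) (sym (unshift j)))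
    where
    k = x * pred n
    unshift : ∀ i → i % n ≡ ((i + x) % n + k % n) % n
    unshift i = begin
      i % n                    ≡⟨ [m+kn]%n≡m%n i x n ⟨
      (i + x * n) % n          ≡⟨ %-congˡ (cong (i +_) (trans (cong (x *_) (sym (suc-pred n))) (*-suc x (pred n)))) ⟩
      (i + (x + k)) % n        ≡⟨ %-congˡ (+-assoc i x k) ⟨
      (i + x + k) % n          ≡⟨ %-distribˡ-+ (i + x) k n ⟩
      ((i + x) % n + k % n) % n ∎
      where open ≡-Reasoning

  wrap-<-injective : ∀ {y z} → y < n → z < n → wrap y ≡ wrap z → y ≡ z
  wrap-<-injective {y} {z} y<n z<n eq =
    trans (sym (m<n⇒m%n≡m y<n))
          (trans (sym (toℕ-wrap y)) (trans (cong toℕ eq) (trans (toℕ-wrap z) (m<n⇒m%n≡m z<n))))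

  wrap-injective : ∀ {i j} x → i < n → j < n → wrap (i + x) ≡ wrap (j + x) → i ≡ j
  wrap-injective {i} {j} x i<n j<n eq = begin
    i       ≡⟨ m<n⇒m%n≡m i<n ⟨
    i % n   ≡⟨ %-cancelʳ-+ i j x (trans (sym (toℕ-wrap (i + x))) (trans (cong toℕ eq) (toℕ-wrap (j + x)))) ⟩
    j % n   ≡⟨ m<n⇒m%n≡m j<n ⟩
    j       ∎
    where open ≡-Reasoning

up down antipode : Fin 4 → Fin 4
up       = lookup (# 1 ∷ # 2 ∷ # 3 ∷ # 0 ∷ [])
down     = lookup (# 3 ∷ # 0 ∷ # 1 ∷ # 2 ∷ [])
antipode = lookup (# 2 ∷ # 3 ∷ # 0 ∷ # 1 ∷ [])

row-adjacent : ∀ a b → Adj (Cycle 4) a b → b ≡ up a ⊎ b ≡ down a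
row-adjacent = from-yes (all? λ a → all? λ b → cycle-adjacent? 4 a b →-dec (b Fin.≟ up a ⊎-dec b Fin.≟ down a))

up-adjacent : ∀ a → Adj (Cycle 4) a (up a)
up-adjacent = from-yes (all? λ a → cycle-adjacent? 4 a (up a))

down-adjacent : ∀ a → Adj (Cycle 4) a (down a)
down-adjacent = from-yes (all? λ a → cycle-adjacent? 4 a (down a))

down-up : ∀ a → down (up a) ≡ a
down-up = from-yes (all? λ a → down (up a) Fin.≟ a)

up-down : ∀ a → up (down a) ≡ a
up-down = from-yes (all? λ a → up (down a) Fin.≟ a)

up-up : ∀ a → up (up a) ≡ antipode a
up-up = from-yes (all? λ a → up (up a) Fin.≟ antipode a)

down-down : ∀ a → down (down a) ≡ antipode a
down-down = from-yes (all? λ a → down (down a) Fin.≟ antipode a)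

up-antipode-adjacent : ∀ a → Adj (Cycle 4) (up a) (antipode a)
up-antipode-adjacent = from-yes (all? λ a → cycle-adjacent? 4 (up a) (antipode a))

antipode-involutive : ∀ a → antipode (antipode a) ≡ a
antipode-involutive = from-yes (all? λ a → antipode (antipode a) Fin.≟ a)

antipode-≢ : ∀ a → a ≢ antipode a
antipode-≢ = from-yes (all? λ a → ¬? (a Fin.≟ antipode a))

∣p∣≡0⇒p⊆q : ∀ {m} {p q : Subset m} → ∣ p ∣ ≡ 0 → p ⊆ₛ q
∣p∣≡0⇒p⊆q {p = p} ∣p∣≡0 x∈p =
  absurd (n≮0 (subst (∣ p - _ ∣ <_) ∣p∣≡0 (x∈p⇒∣p-x∣<∣p∣ x∈p)))

∣p∣≢0⇒nonempty : ∀ {m} {p : Subset m} → ∣ p ∣ ≢ 0 → Nonempty p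
∣p∣≢0⇒nonempty {m} {p} ∣p∣≢0 with nonempty? p
... | yes ne = ne
... | no empty = absurd (∣p∣≢0 (trans (cong ∣_∣ (Empty-unique empty)) (∣⊥∣≡0 m)))

∣p∣≤1⇒p⊆⁅x⁆ : ∀ {m} {p : Subset m} {x} → x ∈ₛ p → ∣ p ∣ ≤ 1 → p ⊆ₛ ⁅ x ⁆
∣p∣≤1⇒p⊆⁅x⁆ {x = x} x∈p ∣p∣≤1 {y} y∈p with y Fin.≟ x
... | yes refl = x∈⁅x⁆ x
... | no y≢x = absurd (n≮0 (≤-trans (x∈p⇒∣p-x∣<∣p∣ (x∈p∧x≢y⇒x∈p-y y∈p y≢x))
                                    (s≤s⁻¹ (≤-trans (x∈p⇒∣p-x∣<∣p∣ x∈p) ∣p∣≤1))))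

∣p∣≤1⇒⊆⁅⁆ : ∀ {m} (p : Subset (suc m)) → ∣ p ∣ ≤ 1 → ∃[ x ] p ⊆ₛ ⁅ x ⁆
∣p∣≤1⇒⊆⁅⁆ p ∣p∣≤1 with nonempty? p
... | yes (x , x∈p) = x , ∣p∣≤1⇒p⊆⁅x⁆ x∈p ∣p∣≤1
... | no empty = zero , λ {y} y∈p → absurd (empty (y , y∈p))

∣p∪q∣≤∣p∣+∣q∣ : ∀ {m} (p q : Subset m) → ∣ p ∪ q ∣ ≤ ∣ p ∣ + ∣ q ∣
∣p∪q∣≤∣p∣+∣q∣ [] [] = z≤n
∣p∪q∣≤∣p∣+∣q∣ (outside ∷ p) (outside ∷ q) = ∣p∪q∣≤∣p∣+∣q∣ p q
∣p∪q∣≤∣p∣+∣q∣ (outside ∷ p) (inside ∷ q) =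
  ≤-trans (s≤s (∣p∪q∣≤∣p∣+∣q∣ p q)) (≤-reflexive (sym (+-suc ∣ p ∣ ∣ q ∣)))
∣p∪q∣≤∣p∣+∣q∣ (inside ∷ p) (y ∷ q) =
  s≤s (≤-trans (∣p∪q∣≤∣p∣+∣q∣ p q) (+-monoʳ-≤ ∣ p ∣ (∣p∣≤∣x∷p∣ y q)))

-- A column records the occupied rows of one copy of C₄; a window shows five consecutive
-- columns x, …, x + 4 of a strip, so its centre column 2 is column x + 2.
Column : Set
Column = Subset 4

Window : Set
Window = Fin 5 → Column

Cell : Set
Cell = Fin 5 × Fin 4

Marked : Window → Cell → Set
Marked W (j , r) = r ∈ₛ W j

marked? : ∀ W c → Dec (Marked W c)
marked? W (j , r) = r ∈ₛ? W j

centre : Fin 4 → Cell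
centre a = # 2 , a

neighbour : Fin 4 → Fin 4 → Cell
neighbour a = lookup ((# 1 , a) ∷ (# 3 , a) ∷ (# 2 , up a) ∷ (# 2 , down a) ∷ [])

second-neighbour : Fin 4 → Fin 7 → Cell
second-neighbour a = lookup ((# 0 , a) ∷ (# 1 , up a) ∷ (# 1 , down a) ∷ (# 2 , antipode a)
                             ∷ (# 3 , up a) ∷ (# 3 , down a) ∷ (# 4 , a) ∷ [])

_≟ᶜ_ : (c c′ : Cell) → Dec (c ≡ c′)
_≟ᶜ_ = ≡-dec Fin._≟_ Fin._≟_

second-neighbour-injective : ∀ a i j → second-neighbour a i ≡ second-neighbour a j → i ≡ j
second-neighbour-injective = from-yes (all? λ a → all? λ i → all? λ j →
  (second-neighbour a i ≟ᶜ second-neighbour a j) →-dec (i Fin.≟ j))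

second-neighbour≢neighbour : ∀ a i k → second-neighbour a i ≢ neighbour a k
second-neighbour≢neighbour = from-yes (all? λ a → all? λ i → all? λ k →
  ¬? (second-neighbour a i ≟ᶜ neighbour a k))

Dominated : Window → Fin 4 → Set
Dominated W a = Marked W (centre a)
              ⊎ (∃[ k ] Marked W (neighbour a k))
              ⊎ (∃₂ λ i j → i ≢ j × Marked W (second-neighbour a i) × Marked W (second-neighbour a j))

dominated? : ∀ W a → Dec (Dominated W a)
dominated? W a = marked? W (centre a)
           ⊎-dec any? (λ k → marked? W (neighbour a k))
           ⊎-dec any? (λ i → any? λ j → ¬? (i Fin.≟ j) ×-dec marked? W (second-neighbour a i)
                                                   ×-dec marked? W (second-neighbour a j))

AllDominated : Window → Set
AllDominated W = ∀ a → Dominated W a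

allDominated? : ∀ W → Dec (AllDominated W)
allDominated? W = all? (dominated? W)

_⊆ʷ_ : Window → Window → Set
W ⊆ʷ W′ = ∀ j → W j ⊆ₛ W′ j

allDominated-mono : ∀ {W W′} → W ⊆ʷ W′ → AllDominated W → AllDominated W′
allDominated-mono W⊆W′ dom a with dom a
... | inj₁ m = inj₁ (W⊆W′ _ m)
... | inj₂ (inj₁ (k , m)) = inj₂ (inj₁ (k , W⊆W′ _ m))
... | inj₂ (inj₂ (i , j , i≢j , mᵢ , mⱼ)) = inj₂ (inj₂ (i , j , i≢j , W⊆W′ _ mᵢ , W⊆W′ _ mⱼ))

window : (ℕ → Column) → ℕ → Window
window σ x j = σ (toℕ j + x)

strip : List Column → ℕ → Column
strip [] _ = ⊥
strip (c ∷ cs) zero = c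
strip (c ∷ cs) (suc y) = strip cs y

lone : Fin 4 → Fin 4 → Fin 4 → Column
lone i p k = if does (k Fin.≟ i) then ⁅ p ⁆ else ⊥

lone-strip : Fin 4 → Fin 4 → ℕ → Column
lone-strip i p = strip (⊤ ∷ lone i p (# 0) ∷ lone i p (# 1) ∷ lone i p (# 2) ∷ lone i p (# 3) ∷ ⊤ ∷ [])

lone-undominated : ∀ i p → ¬ (AllDominated (window (lone-strip i p) 0) × AllDominated (window (lone-strip i p) 1))
lone-undominated = from-yes (all? λ i → all? λ p →
  ¬? (allDominated? (window (lone-strip i p) 0) ×-dec allDominated? (window (lone-strip i p) 1)))

alternation : ∀ p q → AllDominated (window (strip (⊥ ∷ ⁅ p ⁆ ∷ ⊥ ∷ ⁅ q ⁆ ∷ ⊥ ∷ [])) 0) →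
              q ≡ antipode p
alternation = from-yes (all? λ p → all? λ q →
  allDominated? (window (strip (⊥ ∷ ⁅ p ⁆ ∷ ⊥ ∷ ⁅ q ⁆ ∷ ⊥ ∷ [])) 0) →-dec (q Fin.≟ antipode p))

m+n≤1⇒m≡0∨n≡0 : ∀ {a b} → a + b ≤ 1 → (a ≡ 0 × b ≤ 1) ⊎ (a ≤ 1 × b ≡ 0)
m+n≤1⇒m≡0∨n≡0 {zero} a+b≤1 = inj₁ (refl , a+b≤1)
m+n≤1⇒m≡0∨n≡0 {suc a} {zero} a+b≤1 = inj₂ (≤-trans (m≤m+n (suc a) 0) a+b≤1 , refl)
m+n≤1⇒m≡0∨n≡0 {suc a} {suc b} a+b≤1 = absurd (n≮0 (≤-trans (m≤n+m (suc b) a) (s≤s⁻¹ a+b≤1)))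

sparse-block : ∀ {c₁ c₂ c₃ c₄ : Column} → ∣ c₁ ∣ + ∣ c₂ ∣ + ∣ c₃ ∣ + ∣ c₄ ∣ ≤ 1 →
  ∃₂ λ i p → c₁ ⊆ₛ lone i p (# 0) × c₂ ⊆ₛ lone i p (# 1)
           × c₃ ⊆ₛ lone i p (# 2) × c₄ ⊆ₛ lone i p (# 3)
sparse-block {c₁} {c₂} {c₃} {c₄} light with m+n≤1⇒m≡0∨n≡0 light
... | inj₁ (≡0 , ≤1) = let p , ⊆p = ∣p∣≤1⇒⊆⁅⁆ c₄ ≤1 in
  # 3 , p , ∣p∣≡0⇒p⊆q (m+n≡0⇒m≡0 ∣ c₁ ∣ (m+n≡0⇒m≡0 (∣ c₁ ∣ + ∣ c₂ ∣) ≡0))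
          , ∣p∣≡0⇒p⊆q (m+n≡0⇒n≡0 ∣ c₁ ∣ (m+n≡0⇒m≡0 (∣ c₁ ∣ + ∣ c₂ ∣) ≡0))
          , ∣p∣≡0⇒p⊆q (m+n≡0⇒n≡0 (∣ c₁ ∣ + ∣ c₂ ∣) ≡0) , ⊆p
... | inj₂ (≤1 , ≡0₄) with m+n≤1⇒m≡0∨n≡0 ≤1
...   | inj₁ (≡0 , ≤1′) = let p , ⊆p = ∣p∣≤1⇒⊆⁅⁆ c₃ ≤1′ in
  # 2 , p , ∣p∣≡0⇒p⊆q (m+n≡0⇒m≡0 ∣ c₁ ∣ ≡0) , ∣p∣≡0⇒p⊆q (m+n≡0⇒n≡0 ∣ c₁ ∣ ≡0)
          , ⊆p , ∣p∣≡0⇒p⊆q ≡0₄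
...   | inj₂ (≤1′ , ≡0₃) with m+n≤1⇒m≡0∨n≡0 ≤1′
...     | inj₁ (≡0₁ , ≤1″) = let p , ⊆p = ∣p∣≤1⇒⊆⁅⁆ c₂ ≤1″ in
  # 1 , p , ∣p∣≡0⇒p⊆q ≡0₁ , ⊆p , ∣p∣≡0⇒p⊆q ≡0₃ , ∣p∣≡0⇒p⊆q ≡0₄
...     | inj₂ (≤1″ , ≡0₂) = let p , ⊆p = ∣p∣≤1⇒⊆⁅⁆ c₁ ≤1″ in
  # 0 , p , ⊆p , ∣p∣≡0⇒p⊆q ≡0₂ , ∣p∣≡0⇒p⊆q ≡0₃ , ∣p∣≡0⇒p⊆q ≡0₄

block-weight : ∀ (σ : ℕ → Column) x → AllDominated (window σ x) → AllDominated (window σ (suc x)) →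
               2 ≤ ∣ σ (1 + x) ∣ + ∣ σ (2 + x) ∣ + ∣ σ (3 + x) ∣ + ∣ σ (4 + x) ∣
block-weight σ x left right = ≮⇒≥ λ light →
  let i , p , ⊆₁ , ⊆₂ , ⊆₃ , ⊆₄ = sparse-block (s≤s⁻¹ light)
      left⊆ : window σ x ⊆ʷ window (lone-strip i p) 0
      left⊆ = λ { zero → ⊆⊤ ; (suc zero) → ⊆₁ ; (suc (suc zero)) → ⊆₂
                ; (suc (suc (suc zero))) → ⊆₃ ; (suc (suc (suc (suc zero)))) → ⊆₄ }
      right⊆ : window σ (suc x) ⊆ʷ window (lone-strip i p) 1
      right⊆ = λ { zero → ⊆₁ ; (suc zero) → ⊆₂ ; (suc (suc zero)) → ⊆₃
                 ; (suc (suc (suc zero))) → ⊆₄ ; (suc (suc (suc (suc zero)))) → ⊆⊤ }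
  in lone-undominated i p (allDominated-mono left⊆ left , allDominated-mono right⊆ right)

∑< : ℕ → (ℕ → ℕ) → ℕ
∑< zero f = 0
∑< (suc k) f = ∑< k f + f k

syntax ∑< k (λ y → e) = ∑[ y < k ] e

∑-mono-≤ : ∀ k {f g : ℕ → ℕ} → (∀ y → y < k → f y ≤ g y) → ∑< k f ≤ ∑< k g
∑-mono-≤ zero _ = z≤n
∑-mono-≤ (suc k) f≤g = +-mono-≤ (∑-mono-≤ k λ y y<k → f≤g y (m<n⇒m<1+n y<k)) (f≤g k (n<1+n k))

∑-+ : ∀ k (f g : ℕ → ℕ) → ∑[ y < k ] (f y + g y) ≡ ∑< k f + ∑< k g
∑-+ zero f g = refl
∑-+ (suc k) f g = trans (cong (_+ (f k + g k)) (∑-+ k f g)) (interchange (∑< k f) (∑< k g) (f k) (g k))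

∑-const : ∀ k c → ∑[ _ < k ] c ≡ k * c
∑-const zero c = refl
∑-const (suc k) c = trans (cong (_+ c) (∑-const k c)) (+-comm (k * c) c)

∑-zero : ∀ k {f : ℕ → ℕ} → (∀ y → y < k → f y ≡ 0) → ∑< k f ≡ 0
∑-zero zero _ = refl
∑-zero (suc k) f≡0 = cong₂ _+_ (∑-zero k λ y y<k → f≡0 y (m<n⇒m<1+n y<k)) (f≡0 k (n<1+n k))

∑-≤-single : ∀ k (f : ℕ → ℕ) t → (∀ y → y < k → y ≢ t → f y ≡ 0) → ∑< k f ≤ f t
∑-≤-single zero f t _ = z≤n
∑-≤-single (suc k) f t off with k ℕ.≟ t
... | yes refl = ≤-reflexive (cong (_+ f k) (∑-zero k λ y y<k → off y (m<n⇒m<1+n y<k) (<⇒≢ y<k)))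
... | no k≢t = ≤-trans (≤-reflexive (trans (cong (∑< k f +_) (off k (n<1+n k) k≢t)) (+-identityʳ _)))
                       (∑-≤-single k f t λ y y<k → off y (m<n⇒m<1+n y<k))

∑-front : ∀ k (f : ℕ → ℕ) → ∑< (suc k) f ≡ f 0 + ∑[ y < k ] f (suc y)
∑-front zero f = sym (+-identityʳ (f 0))
∑-front (suc k) f = trans (cong (_+ f (suc k)) (∑-front k f)) (+-assoc (f 0) _ (f (suc k)))

∑-shift : ∀ k (f : ℕ → ℕ) → f k ≡ f 0 → ∑[ y < k ] f (suc y) ≡ ∑< k f
∑-shift k f fk≡f0 = +-cancelˡ-≡ (f 0) _ _ (begin
  f 0 + ∑[ y < k ] f (suc y)  ≡⟨ ∑-front k f ⟨
  ∑< k f + f k                ≡⟨ cong (∑< k f +_) fk≡f0 ⟩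
  ∑< k f + f 0                ≡⟨ +-comm (∑< k f) (f 0) ⟩
  f 0 + ∑< k f                ∎)
  where open ≡-Reasoning

∑-periodic-shift : ∀ k (f : ℕ → ℕ) → (∀ y → f (k + y) ≡ f y) →
                   ∀ j → ∑[ y < k ] f (j + y) ≡ ∑< k f
∑-periodic-shift k f periodic zero = refl
∑-periodic-shift k f periodic (suc j) =
  trans (∑-periodic-shift k (λ y → f (suc y)) periodic′ j)
        (∑-shift k f (trans (cong f (sym (+-identityʳ k))) (periodic 0)))
  where
  periodic′ : ∀ y → f (suc (k + y)) ≡ f (suc y)
  periodic′ y = trans (cong f (sym (+-suc k y))) (periodic (suc y))

∑-tight : ∀ k (f : ℕ → ℕ) m → (∀ y → m ≤ f y) → ∑< k f ≤ k * m → ∀ y → y < k → f y ≡ m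
∑-tight (suc k) f m m≤f tight y y<1+k with m≤n⇒m<n∨m≡n (s≤s⁻¹ y<1+k)
... | inj₁ y<k = ∑-tight k f m m≤f rest≤ y y<k
  where
  rest≤ : ∑< k f ≤ k * m
  rest≤ = +-cancelʳ-≤ m (∑< k f) (k * m)
    (≤-trans (+-monoʳ-≤ (∑< k f) (m≤f k)) (≤-trans tight (≤-reflexive (+-comm m (k * m)))))
... | inj₂ refl = ≤-antisym last≤ (m≤f y)
  where
  lower : k * m ≤ ∑< k f
  lower = ≤-trans (≤-reflexive (sym (∑-const k m))) (∑-mono-≤ k λ z _ → m≤f z)
  last≤ : f y ≤ m
  last≤ = +-cancelˡ-≤ (k * m) (f y) m
    (≤-trans (+-monoˡ-≤ (f y) lower) (≤-trans tight (≤-reflexive (+-comm m (k * m)))))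

periodic-+* : ∀ {A : Set} {k} (f : ℕ → A) → (∀ y → f (k + y) ≡ f y) → ∀ q r → f (q * k + r) ≡ f r
periodic-+* f periodic zero r = refl
periodic-+* {k = k} f periodic (suc q) r =
  trans (cong f (+-assoc k (q * k) r)) (trans (periodic (q * k + r)) (periodic-+* f periodic q r))

periodic-% : ∀ {A : Set} {k} .{{_ : NonZero k}} (f : ℕ → A) → (∀ y → f (k + y) ≡ f y) →
             ∀ y → f y ≡ f (y % k)
periodic-% {k = k} f periodic y =
  trans (cong f (trans (m≡m%n+[m/n]*n y k) (+-comm (y % k) (y / k * k))))
        (periodic-+* f periodic (y / k) (y % k))

⌊q*4+k/2⌋ : ∀ q k → ⌊ q * 4 + k /2⌋ ≡ q * 2 + ⌊ k /2⌋
⌊q*4+k/2⌋ zero k = refl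
⌊q*4+k/2⌋ (suc q) k = cong (λ m → suc (suc m)) (⌊q*4+k/2⌋ q k)

⌈q*4+k/2⌉ : ∀ q k → ⌈ q * 4 + k /2⌉ ≡ ⌈ k /2⌉ + q * 2
⌈q*4+k/2⌉ q k = trans (cong ⌊_/2⌋ (sym (+-suc (q * 4) k)))
                      (trans (⌊q*4+k/2⌋ q (suc k)) (+-comm (q * 2) ⌈ k /2⌉))

target-residue : ∀ q r → r < 4 →
                 target (q * 4 + r) ≡ (if r ≡ᵇ 2 then (q * 4 + r) / 2 + 1 else ⌈ q * 4 + r /2⌉)
target-residue q r r<4 = cong (λ m → if m ≡ᵇ 2 then (q * 4 + r) / 2 + 1 else ⌈ q * 4 + r /2⌉)
  (trans (%-congˡ (+-comm (q * 4) r)) (trans ([m+kn]%n≡m%n r q 4) (m<n⇒m%n≡m r<4)))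

target-0 : ∀ q → target (q * 4 + 0) ≡ q * 2
target-0 q = trans (target-residue q 0 (s≤s z≤n)) (⌈q*4+k/2⌉ q 0)

target-1 : ∀ q → target (q * 4 + 1) ≡ 1 + q * 2
target-1 q = trans (target-residue q 1 (s≤s (s≤s z≤n))) (⌈q*4+k/2⌉ q 1)

target-2 : ∀ q → target (q * 4 + 2) ≡ 2 + q * 2
target-2 q = trans (target-residue q 2 (s≤s (s≤s (s≤s z≤n))))
  (trans (cong (λ m → m / 2 + 1) (solve 1 (λ q → q :* con 4 :+ con 2 := (con 1 :+ q :* con 2) :* con 2) refl q))
         (trans (cong (_+ 1) (m*n/n≡m (1 + q * 2) 2)) (+-comm (1 + q * 2) 1)))

target-3 : ∀ q → target (q * 4 + 3) ≡ 2 + q * 2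
target-3 q = trans (target-residue q 3 ≤-refl) (⌈q*4+k/2⌉ q 3)

residue : ∀ n → ∃₂ λ q r → r < 4 × n ≡ q * 4 + r
residue n = n / 4 , n % 4 , m%n<n n 4 , trans (m≡m%n+[m/n]*n n 4) (+-comm (n % 4) (n / 4 * 4))

2*[q*4+r] : ∀ q r → 2 * (q * 4 + r) ≡ 4 * (q * 2) + 2 * r
2*[q*4+r] = solve 2 (λ q r → con 2 :* (q :* con 4 :+ r) := con 4 :* (q :* con 2) :+ con 2 :* r) refl

4*[1+m] : ∀ m → 4 * (1 + m) ≡ 4 * m + 4
4*[1+m] m = trans (*-distribˡ-+ 4 1 m) (+-comm 4 (4 * m))

target-least : ∀ n t → 2 * n ≤ 4 * t → (∀ q → n ≡ q * 4 + 2 → 4 * t ≤ 2 * n → Empty) → target n ≤ t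
target-least n t lower not-tight with residue n
... | q , 0 , _ , refl = subst (_≤ t) (sym (target-0 q))
  (*-cancelˡ-≤ 4 (≤-trans (≤-reflexive (sym (trans (2*[q*4+r] q 0) (+-identityʳ _)))) lower))
... | q , 1 , _ , refl = subst (_≤ t) (sym (target-1 q))
  (*-cancelˡ-< 4 (q * 2) t (≤-trans (m<m+n (4 * (q * 2)) (s≤s z≤n))
                                    (≤-trans (≤-reflexive (sym (2*[q*4+r] q 1))) lower)))
... | q , 2 , _ , refl = subst (_≤ t) (sym (target-2 q))
  (*-cancelˡ-< 4 (1 + q * 2) t (≤-trans (≤-reflexive (cong suc (trans (4*[1+m] (q * 2)) (sym (2*[q*4+r] q 2)))))
                                        (≰⇒> (not-tight q refl))))
... | q , 3 , _ , refl = subst (_≤ t) (sym (target-3 q))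
  (*-cancelˡ-< 4 (1 + q * 2) t (≤-trans (≤-reflexive (cong suc (4*[1+m] (q * 2))))
    (≤-trans (+-monoʳ-< (4 * (q * 2)) (s≤s (s≤s (s≤s (s≤s (s≤s z≤n))))))
             (≤-trans (≤-reflexive (sym (2*[q*4+r] q 3))) lower))))
... | q , suc (suc (suc (suc _))) , s≤s (s≤s (s≤s (s≤s ()))) , _

m+n≡1⇒m≡1∨n≡1 : ∀ {a b} → a + b ≡ 1 → a ≡ 1 ⊎ b ≡ 1
m+n≡1⇒m≡1∨n≡1 {zero} a+b≡1 = inj₂ a+b≡1
m+n≡1⇒m≡1∨n≡1 {suc zero} _ = inj₁ refl

m+m≡2⇒m≡1 : ∀ m → m + m ≡ 2 → m ≡ 1
m+m≡2⇒m≡1 (suc zero) _ = refl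
m+m≡2⇒m≡1 (suc (suc m)) m+m≡2 with m+n≡0⇒n≡0 m (suc-injective (suc-injective m+m≡2))
... | ()

module PeriodicStrip (n : ℕ) {{_ : NonZero n}} (σ : ℕ → Column)
  (periodic : ∀ y → σ (n + y) ≡ σ y) (dominated : ∀ x → AllDominated (window σ x)) where

  total : ℕ
  total = ∑[ y < n ] ∣ σ y ∣

  block : ℕ → ℕ
  block x = ∣ σ (1 + x) ∣ + ∣ σ (2 + x) ∣ + ∣ σ (3 + x) ∣ + ∣ σ (4 + x) ∣

  block≥2 : ∀ x → 2 ≤ block x
  block≥2 x = block-weight σ x (dominated x) (dominated (suc x))

  weight-shift : ∀ j y → ∣ σ (j + (n + y)) ∣ ≡ ∣ σ (j + y) ∣
  weight-shift j y = cong ∣_∣ (trans (cong σ (x∙yz≈y∙xz j n y)) (periodic (j + y)))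

  block-periodic : ∀ y → block (n + y) ≡ block y
  block-periodic y =
    cong₂ _+_ (cong₂ _+_ (cong₂ _+_ (weight-shift 1 y) (weight-shift 2 y)) (weight-shift 3 y)) (weight-shift 4 y)

  ∑-block : ∑< n block ≡ 4 * total
  ∑-block = begin
    ∑< n block                                   ≡⟨ ∑-+ n _ _ ⟩
    ∑< n (λ x → w 1 x + w 2 x + w 3 x) + ∑w 4    ≡⟨ cong (_+ ∑w 4) (∑-+ n _ _) ⟩
    ∑< n (λ x → w 1 x + w 2 x) + ∑w 3 + ∑w 4     ≡⟨ cong (λ s → s + ∑w 3 + ∑w 4) (∑-+ n _ _) ⟩
    ∑w 1 + ∑w 2 + ∑w 3 + ∑w 4                    ≡⟨ cong₂ _+_ (cong₂ _+_ (cong₂ _+_ (∑w≡ 1) (∑w≡ 2)) (∑w≡ 3))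
                                                              (∑w≡ 4) ⟩
    total + total + total + total                ≡⟨ solve 1 (λ t → t :+ t :+ t :+ t := con 4 :* t) refl total ⟩
    4 * total                                    ∎
    where
    open ≡-Reasoning
    w : ℕ → ℕ → ℕ
    w j x = ∣ σ (j + x) ∣
    ∑w : ℕ → ℕ
    ∑w j = ∑< n (w j)
    ∑w≡ : ∀ j → ∑w j ≡ total
    ∑w≡ = ∑-periodic-shift n (λ y → ∣ σ y ∣) (λ y → cong ∣_∣ (periodic y))

  total-bound : 2 * n ≤ 4 * total
  total-bound = begin
    2 * n          ≡⟨ *-comm 2 n ⟩
    n * 2          ≡⟨ ∑-const n 2 ⟨
    ∑[ _ < n ] 2   ≤⟨ ∑-mono-≤ n (λ x _ → block≥2 x) ⟩
    ∑< n block     ≡⟨ ∑-block ⟩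
    4 * total      ∎
    where open ≤-Reasoning

  blocks-tight : 4 * total ≤ 2 * n → ∀ x → block x ≡ 2
  blocks-tight tight x = trans (periodic-% block block-periodic x)
    (∑-tight n block 2 block≥2 (≤-trans (≤-reflexive ∑-block) (≤-trans tight (≤-reflexive (*-comm 2 n))))
             (x % n) (m%n<n x n))

  module Tight (q : ℕ) (n≡ : n ≡ q * 4 + 2) (blocks≡2 : ∀ x → block x ≡ 2) where

    -- shifted by one so that block x unfolds to D x + D (1 + x) + D (2 + x) + D (3 + x)
    D : ℕ → ℕ
    D y = ∣ σ (suc y) ∣

    D-4 : ∀ y → D (4 + y) ≡ D y
    D-4 y = +-cancelˡ-≡ (D (1 + y) + D (2 + y) + D (3 + y)) _ _
      (trans (blocks≡2 (suc y)) (trans (sym (blocks≡2 y)) (rotate (D y) (D (1 + y)) (D (2 + y)) (D (3 + y)))))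
      where
      rotate : ∀ a b c d → a + b + c + d ≡ b + c + d + a
      rotate = solve 4 (λ a b c d → a :+ b :+ c :+ d := b :+ c :+ d :+ a) refl

    D-2 : ∀ y → D (2 + y) ≡ D y
    D-2 y = begin
      D (2 + y)            ≡⟨ periodic-+* D D-4 q (2 + y) ⟨
      D (q * 4 + (2 + y))  ≡⟨ cong D (+-assoc (q * 4) 2 y) ⟨
      D (q * 4 + 2 + y)    ≡⟨ cong (λ m → D (m + y)) n≡ ⟨
      D (n + y)            ≡⟨ cong ∣_∣ (trans (cong σ (sym (+-suc n y))) (periodic (suc y))) ⟩
      D y                  ∎
      where open ≡-Reasoning

    D-pair : ∀ y → D y + D (1 + y) ≡ 1
    D-pair y = m+m≡2⇒m≡1 (D y + D (1 + y)) (begin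
      D y + D (1 + y) + (D y + D (1 + y))  ≡⟨ +-assoc (D y + D (1 + y)) (D y) (D (1 + y)) ⟨
      D y + D (1 + y) + D y + D (1 + y)    ≡⟨ cong₂ (λ a b → D y + D (1 + y) + a + b) (D-2 y) (D-2 (1 + y)) ⟨
      block y                              ≡⟨ blocks≡2 y ⟩
      2                                    ∎)
      where open ≡-Reasoning

    step : ∀ y {p} → D (1 + y) ≡ 1 → p ∈ₛ σ (2 + y) → antipode p ∈ₛ σ (4 + y)
    step y {p} one p∈ =
      subst (_∈ₛ σ (4 + y)) (alternation p p′ (allDominated-mono ⊆pattern (dominated (suc y)))) p′∈
      where
      empty-before : D y ≡ 0
      empty-before = +-cancelʳ-≡ 1 (D y) 0 (trans (cong (D y +_) (sym one)) (D-pair y))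
      next-nonempty : Nonempty (σ (4 + y))
      next-nonempty = ∣p∣≢0⇒nonempty (λ ≡0 → 0≢1+n (trans (sym ≡0) (trans (D-2 (1 + y)) one)))
      p′ : Fin 4
      p′ = proj₁ next-nonempty
      p′∈ : p′ ∈ₛ σ (4 + y)
      p′∈ = proj₂ next-nonempty
      ⊆pattern : window σ (suc y) ⊆ʷ window (strip (⊥ ∷ ⁅ p ⁆ ∷ ⊥ ∷ ⁅ p′ ⁆ ∷ ⊥ ∷ [])) 0
      ⊆pattern zero = ∣p∣≡0⇒p⊆q empty-before
      ⊆pattern (suc zero) = ∣p∣≤1⇒p⊆⁅x⁆ p∈ (≤-reflexive one)
      ⊆pattern (suc (suc zero)) = ∣p∣≡0⇒p⊆q (trans (D-2 y) empty-before)
      ⊆pattern (suc (suc (suc zero))) = ∣p∣≤1⇒p⊆⁅x⁆ p′∈ (≤-reflexive (trans (D-2 (1 + y)) one))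
      ⊆pattern (suc (suc (suc (suc zero)))) = ∣p∣≡0⇒p⊆q (trans (D-4 y) empty-before)

    iterate : ∀ y {p} → D (1 + y) ≡ 1 → p ∈ₛ σ (2 + y) →
              ∀ k → D (1 + (k * 4 + y)) ≡ 1 × p ∈ₛ σ (2 + (k * 4 + y))
    iterate y one p∈ zero = one , p∈
    iterate y {p} one p∈ (suc k) =
      let one′ , p∈′ = iterate y one p∈ k
      in trans (D-4 (1 + (k * 4 + y))) one′
       , subst (_∈ₛ σ (6 + (k * 4 + y))) (antipode-involutive p)
               (step (2 + (k * 4 + y)) (trans (D-2 (1 + (k * 4 + y))) one′) (step (k * 4 + y) one′ p∈′))

    single-vertex-column-impossible : ∀ y → D (1 + y) ≡ 1 → Empty
    single-vertex-column-impossible y one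
      with ∣p∣≢0⇒nonempty {p = σ (2 + y)} (λ ≡0 → 0≢1+n (trans (sym ≡0) one))
    ... | p , p∈ = antipode-≢ p (sym (x∈⁅y⁆⇒x≡y p (∣p∣≤1⇒p⊆⁅x⁆ p∈ (≤-reflexive one) antipode∈)))
      where
      -- one step and q double steps lead from column 2 + y once around the torus
      around : 2 + (q * 4 + (2 + y)) ≡ n + (2 + y)
      around = trans (x∙yz≈y∙xz 2 (q * 4) (2 + y))
                     (trans (sym (+-assoc (q * 4) 2 (2 + y))) (cong (_+ (2 + y)) (sym n≡)))
      antipode∈ : antipode p ∈ₛ σ (2 + y)
      antipode∈ = subst (antipode p ∈ₛ_) (trans (cong σ around) (periodic (2 + y)))
                        (proj₂ (iterate (2 + y) (trans (D-2 (1 + y)) one) (step y one p∈) q))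

    impossible : Empty
    impossible = [ single-vertex-column-impossible 1 ∘ trans (D-2 0) , single-vertex-column-impossible 0 ]′
                   (m+n≡1⇒m≡1∨n≡1 (D-pair 0))

  target≤total : target n ≤ total
  target≤total = target-least n total total-bound λ q n≡ tight → Tight.impossible q n≡ (blocks-tight tight)

module Torus (n : ℕ) {{_ : NonZero n}} where

  open Wrap n public

  Γ : Graph
  Γ = Cycle 4 □ Cycle n

  Vertex : Set
  Vertex = Fin 4 × Fin n

  _≟ᵥ_ : (u v : Vertex) → Dec (u ≡ v)
  _≟ᵥ_ = ≡-dec Fin._≟_ Fin._≟_

  open Membership _≟ᵥ_ using (_∈?_)

  DisjDominated : List Vertex → Vertex → Set
  DisjDominated S v = (∃[ s ] (s ∈ S × DistEq Γ 1 v s))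
                    ⊎ (∃[ s ] ∃[ t ] (s ∈ S × t ∈ S × ¬ s ≡ t × DistEq Γ 2 v s × DistEq Γ 2 v t))

  place : ℕ → Cell → Vertex
  place x (j , r) = r , wrap (toℕ j + x)

  adjacent-cases : ∀ y b {s} → Adj Γ (b , wrap (suc y)) s →
    s ≡ (b , wrap y) ⊎ s ≡ (b , wrap (2 + y)) ⊎ s ≡ (up b , wrap (suc y)) ⊎ s ≡ (down b , wrap (suc y))
  adjacent-cases y b {_ , c} (inj₁ (refl , c~)) with wrap-adjacent y c~
  ... | inj₁ refl = inj₂ (inj₁ refl)
  ... | inj₂ refl = inj₁ refl
  adjacent-cases y b {b′ , _} (inj₂ (refl , b~)) with row-adjacent b b′ b~
  ... | inj₁ refl = inj₂ (inj₂ (inj₁ refl))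
  ... | inj₂ refl = inj₂ (inj₂ (inj₂ refl))

  adjacent-centre : ∀ x a {s} → Adj Γ (place x (centre a)) s → ∃[ k ] s ≡ place x (neighbour a k)
  adjacent-centre x a s~ with adjacent-cases (suc x) a s~
  ... | inj₁ eq = # 0 , eq
  ... | inj₂ (inj₁ eq) = # 1 , eq
  ... | inj₂ (inj₂ (inj₁ eq)) = # 2 , eq
  ... | inj₂ (inj₂ (inj₂ eq)) = # 3 , eq

  neighbour-adjacent : ∀ x a k → Adj Γ (place x (centre a)) (place x (neighbour a k))
  neighbour-adjacent x a zero = inj₁ (refl , inj₂ (wrap-Next (suc x)))
  neighbour-adjacent x a (suc zero) = inj₁ (refl , inj₁ (wrap-Next (2 + x)))
  neighbour-adjacent x a (suc (suc zero)) = inj₂ (refl , up-adjacent a)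
  neighbour-adjacent x a (suc (suc (suc zero))) = inj₂ (refl , down-adjacent a)

  adjacent-neighbour : ∀ x a k {s} → Adj Γ (place x (neighbour a k)) s →
    s ≡ place x (centre a) ⊎ ∃[ i ] s ≡ place x (second-neighbour a i)
  adjacent-neighbour x a zero s~ with adjacent-cases x a s~
  ... | inj₁ refl = inj₂ (# 0 , refl)
  ... | inj₂ (inj₁ refl) = inj₁ refl
  ... | inj₂ (inj₂ (inj₁ refl)) = inj₂ (# 1 , refl)
  ... | inj₂ (inj₂ (inj₂ refl)) = inj₂ (# 2 , refl)
  adjacent-neighbour x a (suc zero) s~ with adjacent-cases (2 + x) a s~
  ... | inj₁ refl = inj₁ refl
  ... | inj₂ (inj₁ refl) = inj₂ (# 6 , refl)
  ... | inj₂ (inj₂ (inj₁ refl)) = inj₂ (# 4 , refl)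
  ... | inj₂ (inj₂ (inj₂ refl)) = inj₂ (# 5 , refl)
  adjacent-neighbour x a (suc (suc zero)) s~ with adjacent-cases (suc x) (up a) s~
  ... | inj₁ refl = inj₂ (# 1 , refl)
  ... | inj₂ (inj₁ refl) = inj₂ (# 4 , refl)
  ... | inj₂ (inj₂ (inj₁ refl)) = inj₂ (# 3 , cong (_, _) (up-up a))
  ... | inj₂ (inj₂ (inj₂ refl)) = inj₁ (cong (_, _) (down-up a))
  adjacent-neighbour x a (suc (suc (suc zero))) s~ with adjacent-cases (suc x) (down a) s~
  ... | inj₁ refl = inj₂ (# 2 , refl)
  ... | inj₂ (inj₁ refl) = inj₂ (# 5 , refl)
  ... | inj₂ (inj₂ (inj₁ refl)) = inj₁ (cong (_, _) (up-down a))
  ... | inj₂ (inj₂ (inj₂ refl)) = inj₂ (# 3 , cong (_, _) (down-down a))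

  second-neighbour-walk : ∀ x a i → Walk Γ (place x (centre a)) (place x (second-neighbour a i)) 2
  second-neighbour-walk x a zero = neighbour-adjacent x a (# 0) ∷ inj₁ (refl , inj₂ (wrap-Next x)) ∷ []
  second-neighbour-walk x a (suc zero) = neighbour-adjacent x a (# 0) ∷ inj₂ (refl , up-adjacent a) ∷ []
  second-neighbour-walk x a (suc (suc zero)) = neighbour-adjacent x a (# 0) ∷ inj₂ (refl , down-adjacent a) ∷ []
  second-neighbour-walk x a (suc (suc (suc zero))) =
    neighbour-adjacent x a (# 2) ∷ inj₂ (refl , up-antipode-adjacent a) ∷ []
  second-neighbour-walk x a (suc (suc (suc (suc zero)))) =
    neighbour-adjacent x a (# 1) ∷ inj₂ (refl , up-adjacent a) ∷ []
  second-neighbour-walk x a (suc (suc (suc (suc (suc zero))))) =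
    neighbour-adjacent x a (# 1) ∷ inj₂ (refl , down-adjacent a) ∷ []
  second-neighbour-walk x a (suc (suc (suc (suc (suc (suc zero)))))) =
    neighbour-adjacent x a (# 1) ∷ inj₁ (refl , inj₁ (wrap-Next (3 + x))) ∷ []

  distance-one : ∀ x a {s} → DistEq Γ 1 (place x (centre a)) s → ∃[ k ] s ≡ place x (neighbour a k)
  distance-one x a ((zero , _ , []) , not-0) = absurd (not-0 (0 , z≤n , []))
  distance-one x a ((suc zero , _ , s~ ∷ []) , _) = adjacent-centre x a s~
  distance-one x a ((suc (suc _) , s≤s () , _) , _)

  distance-two : ∀ x a {s} → DistEq Γ 2 (place x (centre a)) s → ∃[ i ] s ≡ place x (second-neighbour a i)
  distance-two x a ((zero , _ , walk) , not-≤1) = absurd (not-≤1 (0 , z≤n , walk))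
  distance-two x a ((suc zero , _ , walk) , not-≤1) = absurd (not-≤1 (1 , ≤-refl , walk))
  distance-two x a ((suc (suc zero) , _ , w~ ∷ s~ ∷ []) , not-≤1) with adjacent-centre x a w~
  ... | k , refl with adjacent-neighbour x a k s~
  ...   | inj₁ refl = absurd (not-≤1 (0 , z≤n , []))
  ...   | inj₂ found = found
  distance-two x a ((suc (suc (suc _)) , s≤s (s≤s ()) , _) , _)

  mark : Vertex → Fin n → Column
  mark (r , c′) c = if does (c′ Fin.≟ c) then ⁅ r ⁆ else ⊥

  column : List Vertex → Fin n → Column
  column [] c = ⊥
  column (v ∷ S) c = mark v c ∪ column S c

  ∈-column : ∀ {S r c} → (r , c) ∈ S → r ∈ₛ column S c
  ∈-column {c = c} (here refl) with c Fin.≟ c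
  ... | yes _ = x∈p∪q⁺ (inj₁ (x∈⁅x⁆ _))
  ... | no c≢c = absurd (c≢c refl)
  ∈-column (there r,c∈S) = x∈p∪q⁺ (inj₂ (∈-column r,c∈S))

  isDisjDom⇒dominated : ∀ {S} → IsDisjDom Γ S → ∀ x → AllDominated (window (column S ∘ wrap) x)
  isDisjDom⇒dominated {S} dds x a with place x (centre a) ∈? S
  ... | yes centre∈ = inj₁ (∈-column centre∈)
  ... | no centre∉ with dds _ centre∉
  ...   | inj₁ (s , s∈ , one) with distance-one x a one
  ...     | k , refl = inj₂ (inj₁ (k , ∈-column s∈))
  isDisjDom⇒dominated dds x a | no _ | inj₂ (s , t , s∈ , t∈ , s≢t , twoₛ , twoₜ)
    with distance-two x a twoₛ | distance-two x a twoₜ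
  ... | i , refl | j , refl = inj₂ (inj₂ (i , j , (λ { refl → s≢t refl }) , ∈-column s∈ , ∈-column t∈))

  ∣mark∣≤1 : ∀ v c → ∣ mark v c ∣ ≤ 1
  ∣mark∣≤1 (r , c′) c with c′ Fin.≟ c
  ... | yes _ = ≤-reflexive (∣⁅x⁆∣≡1 r)
  ... | no _ = ≤-trans (≤-reflexive (∣⊥∣≡0 4)) z≤n

  ∣mark∣≡0 : ∀ r c′ y → y < n → y ≢ toℕ c′ → ∣ mark (r , c′) (wrap y) ∣ ≡ 0
  ∣mark∣≡0 r c′ y y<n y≢c′ with c′ Fin.≟ wrap y
  ... | yes refl = absurd (y≢c′ (trans (sym (m<n⇒m%n≡m y<n)) (sym (toℕ-wrap y))))
  ... | no _ = ∣⊥∣≡0 4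

  columns-total : ∀ S → ∑[ y < n ] ∣ column S (wrap y) ∣ ≤ length S
  columns-total [] = ≤-reflexive (∑-zero n λ _ _ → ∣⊥∣≡0 4)
  columns-total (v@(r , c′) ∷ S) = begin
    ∑[ y < n ] ∣ mark v (wrap y) ∪ column S (wrap y) ∣
      ≤⟨ ∑-mono-≤ n (λ y _ → ∣p∪q∣≤∣p∣+∣q∣ (mark v (wrap y)) (column S (wrap y))) ⟩
    ∑[ y < n ] (∣ mark v (wrap y) ∣ + ∣ column S (wrap y) ∣)          ≡⟨ ∑-+ n _ _ ⟩
    ∑[ y < n ] ∣ mark v (wrap y) ∣ + ∑[ y < n ] ∣ column S (wrap y) ∣ ≤⟨ +-mono-≤ mark-total (columns-total S) ⟩
    1 + length S                                                      ∎
    where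
    open ≤-Reasoning
    mark-total : ∑[ y < n ] ∣ mark v (wrap y) ∣ ≤ 1
    mark-total = ≤-trans (∑-≤-single n _ (toℕ c′) (∣mark∣≡0 r c′)) (∣mark∣≤1 v _)

  lower-bound : ∀ S → IsDisjDom Γ S → target n ≤ length S
  lower-bound S dds = ≤-trans
    (PeriodicStrip.target≤total n (column S ∘ wrap) (cong (column S) ∘ wrap-periodic) (isDisjDom⇒dominated dds))
    (columns-total S)

Pattern : Set
Pattern = List (Maybe (Fin 4))

⟦_⟧ : Maybe (Fin 4) → Column
⟦ nothing ⟧ = ⊥
⟦ just p ⟧ = ⁅ p ⁆

windows-dominated : List Column → Bool
windows-dominated (c ∷ cs@(_ ∷ _ ∷ _ ∷ _ ∷ _)) =
  isYes (allDominated? (window (strip (c ∷ cs)) 0)) ∧ windows-dominated cs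
windows-dominated _ = true

windows-dominated-sound : ∀ cs → T (windows-dominated cs) →
                          ∀ x → 5 + x ≤ length cs → AllDominated (window (strip cs) x)
windows-dominated-sound (c ∷ cs@(_ ∷ _ ∷ _ ∷ _ ∷ _)) ok zero _ =
  toWitness {a? = allDominated? (window (strip (c ∷ cs)) 0)}
            (proj₁ (Equivalence.to (T-∧ {isYes (allDominated? (window (strip (c ∷ cs)) 0))}) ok))
windows-dominated-sound (c ∷ cs@(_ ∷ _ ∷ _ ∷ _ ∷ _)) ok (suc x) fits =
  allDominated-mono (λ j → ⊆-reflexive (cong (strip (c ∷ cs)) (sym (+-suc (toℕ j) x))))
    (windows-dominated-sound cs (proj₂ (Equivalence.to (T-∧ {isYes (allDominated? (window (strip (c ∷ cs)) 0))}) ok))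
                             x (s≤s⁻¹ fits))
windows-dominated-sound [] _ _ ()
windows-dominated-sound (_ ∷ []) _ _ (s≤s ())
windows-dominated-sound (_ ∷ _ ∷ []) _ _ (s≤s (s≤s ()))
windows-dominated-sound (_ ∷ _ ∷ _ ∷ []) _ _ (s≤s (s≤s (s≤s ())))
windows-dominated-sound (_ ∷ _ ∷ _ ∷ _ ∷ []) _ _ (s≤s (s≤s (s≤s (s≤s ()))))

strip-++ˡ : ∀ cs ds y → y < length cs → strip (cs ++ ds) y ≡ strip cs y
strip-++ˡ (c ∷ cs) ds zero _ = refl
strip-++ˡ (c ∷ cs) ds (suc y) y< = strip-++ˡ cs ds y (s≤s⁻¹ y<)

strip-++ʳ : ∀ cs ds y → strip (cs ++ ds) (length cs + y) ≡ strip ds y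
strip-++ʳ [] ds y = refl
strip-++ʳ (c ∷ cs) ds y = strip-++ʳ cs ds y

strip-take : ∀ k cs y → y < k → strip (take k cs) y ≡ strip cs y
strip-take (suc k) [] y _ = refl
strip-take (suc k) (c ∷ cs) zero _ = refl
strip-take (suc k) (c ∷ cs) (suc y) y< = strip-take k cs y (s≤s⁻¹ y<)

tile : Pattern
tile = just (# 0) ∷ nothing ∷ just (# 2) ∷ nothing ∷ []

tiles : ℕ → Pattern
tiles zero = []
tiles (suc q) = tile ++ tiles q

-- The four windows starting in the first tile are closed terms that evaluate to true, so
-- windows-dominated passes to the next tile definitionally.
windows-tiles : ∀ q E → windows-dominated (map ⟦_⟧ (tiles (suc q) ++ E) ++ map ⟦_⟧ tile)
                      ≡ windows-dominated (map ⟦_⟧ (tile ++ E) ++ map ⟦_⟧ tile)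
windows-tiles zero E = refl
windows-tiles (suc q) E = windows-tiles q E

length-tiles : ∀ q (E : Pattern) → length (tiles q ++ E) ≡ q * 4 + length E
length-tiles zero E = refl
length-tiles (suc q) E = cong (λ m → suc (suc (suc (suc m)))) (length-tiles q E)

occupied-tiles : ∀ q (E : Pattern) → length (catMaybes (tiles q ++ E)) ≡ q * 2 + length (catMaybes E)
occupied-tiles zero E = refl
occupied-tiles (suc q) E = cong (λ m → suc (suc m)) (occupied-tiles q E)

module Construction (n : ℕ) {{_ : NonZero n}} (5≤n : 5 ≤ n) where

  open Torus n

  place-injective : ∀ x {c c′} → place x c ≡ place x c′ → c ≡ c′
  place-injective x {j , _} {j′ , _} eq = cong₂ _,_
    (toℕ-injective (wrap-injective x (≤-trans (toℕ<n j) 5≤n) (≤-trans (toℕ<n j′) 5≤n) (cong proj₂ eq)))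
    (cong proj₁ eq)

  dominated⇒disjDominated : ∀ {S W} x a → place x (centre a) ∉ S → (∀ {c} → Marked W c → place x c ∈ S) →
                            Dominated W a → DisjDominated S (place x (centre a))
  dominated⇒disjDominated x a centre∉ marked⇒∈ (inj₁ m) = absurd (centre∉ (marked⇒∈ m))
  dominated⇒disjDominated x a centre∉ marked⇒∈ (inj₂ (inj₁ (k , m))) =
    inj₁ (_ , marked⇒∈ m , (1 , ≤-refl , neighbour-adjacent x a k ∷ [])
            , ¬DistLE-0 (∈∉⇒≢ (marked⇒∈ m) centre∉))
  dominated⇒disjDominated {W = W} x a centre∉ marked⇒∈ (inj₂ (inj₂ (i , j , i≢j , mᵢ , mⱼ))) =
    inj₂ (_ , _ , marked⇒∈ mᵢ , marked⇒∈ mⱼ , i≢j ∘ second-neighbour-injective a i j ∘ place-injective x ,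
          exactly-two i mᵢ , exactly-two j mⱼ)
    where
    exactly-two : ∀ i → Marked W (second-neighbour a i) →
                  DistEq Γ 2 (place x (centre a)) (place x (second-neighbour a i))
    exactly-two i m = (2 , ≤-refl , second-neighbour-walk x a i) , not-within-1
      where
      not-within-1 : ¬ DistLE Γ 1 (place x (centre a)) (place x (second-neighbour a i))
      not-within-1 (zero , _ , walk) = ¬DistLE-0 (∈∉⇒≢ (marked⇒∈ m) centre∉) (zero , z≤n , walk)
      not-within-1 (suc zero , _ , adj ∷ []) with adjacent-centre x a adj
      ... | k , eq = second-neighbour≢neighbour a i k (place-injective x eq)
      not-within-1 (suc (suc _) , s≤s () , _)

  placements : ℕ → Pattern → List Vertex
  placements i [] = []
  placements i (nothing ∷ P) = placements (suc i) P
  placements i (just r ∷ P) = (r , wrap i) ∷ placements (suc i) P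

  length-placements : ∀ i P → length (placements i P) ≡ length (catMaybes P)
  length-placements i [] = refl
  length-placements i (nothing ∷ P) = length-placements (suc i) P
  length-placements i (just _ ∷ P) = cong suc (length-placements (suc i) P)

  ∈-placements : ∀ i P y {r} → r ∈ₛ strip (map ⟦_⟧ P) y → (r , wrap (i + y)) ∈ placements i P
  ∈-placements i [] y r∈ = absurd (∉⊥ r∈)
  ∈-placements i (nothing ∷ P) zero r∈ = absurd (∉⊥ r∈)
  ∈-placements i (just p ∷ P) zero r∈ = here (cong₂ _,_ (x∈⁅y⁆⇒x≡y p r∈) (cong wrap (+-identityʳ i)))
  ∈-placements i (nothing ∷ P) (suc y) {r} r∈ =
    subst (λ z → (r , wrap z) ∈ placements (suc i) P) (sym (+-suc i y)) (∈-placements (suc i) P y r∈)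
  ∈-placements i (just _ ∷ P) (suc y) {r} r∈ =
    there (subst (λ z → (r , wrap z) ∈ placements (suc i) P) (sym (+-suc i y)) (∈-placements (suc i) P y r∈))

  placements-columns : ∀ i P {v} → v ∈ placements i P → ∃[ k ] (k < length P × proj₂ v ≡ wrap (i + k))
  placements-columns i (nothing ∷ P) v∈ with placements-columns (suc i) P v∈
  ... | k , k< , eq = suc k , s≤s k< , trans eq (cong wrap (sym (+-suc i k)))
  placements-columns i (just _ ∷ P) (here refl) = 0 , s≤s z≤n , cong wrap (sym (+-identityʳ i))
  placements-columns i (just _ ∷ P) (there v∈) with placements-columns (suc i) P v∈
  ... | k , k< , eq = suc k , s≤s k< , trans eq (cong wrap (sym (+-suc i k)))

  placements-unique : ∀ i P → i + length P ≤ n → Unique (placements i P)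
  placements-unique i [] _ = []
  placements-unique i (nothing ∷ P) fits =
    placements-unique (suc i) P (subst (_≤ n) (+-suc i (length P)) fits)
  placements-unique i (just r ∷ P) fits = All.tabulate head-new ∷ placements-unique (suc i) P fits′
    where
    fits′ : suc i + length P ≤ n
    fits′ = subst (_≤ n) (+-suc i (length P)) fits
    head-new : ∀ {v} → v ∈ placements (suc i) P → (r , wrap i) ≢ v
    head-new v∈ refl with placements-columns (suc i) P v∈
    ... | k , k< , eq = m≢1+m+n i (wrap-<-injective i<n (≤-trans (+-monoʳ-< (suc i) k<) fits′) eq)
      where
      i<n : i < n
      i<n = ≤-trans (s≤s (m≤m+n i k)) (<⇒≤ (≤-trans (+-monoʳ-< (suc i) k<) fits′))

  strip-wrap-around : ∀ cs → length cs ≡ n → ∀ y → y < n + 4 → strip (cs ++ take 4 cs) y ≡ strip cs (y % n)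
  strip-wrap-around cs length-cs y y< with y <? n
  ... | yes y<n = trans (strip-++ˡ cs _ y (subst (y <_) (sym length-cs) y<n))
                        (cong (strip cs) (sym (m<n⇒m%n≡m y<n)))
  ... | no y≮n = begin
    strip (cs ++ take 4 cs) y                ≡⟨ cong (strip (cs ++ take 4 cs)) (trans (cong (_+ k) length-cs) n+k≡y) ⟨
    strip (cs ++ take 4 cs) (length cs + k)  ≡⟨ strip-++ʳ cs _ k ⟩
    strip (take 4 cs) k                      ≡⟨ strip-take 4 cs k k<4 ⟩
    strip cs k                               ≡⟨ cong (strip cs) k≡y%n ⟩
    strip cs (y % n)                         ∎
    where
    open ≡-Reasoning
    k = y ∸ n
    n+k≡y : n + k ≡ y
    n+k≡y = m+[n∸m]≡n (≮⇒≥ y≮n)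
    k<4 : k < 4
    k<4 = +-cancelˡ-< n k 4 (subst (_< n + 4) (sym n+k≡y) y<)
    k≡y%n : k ≡ y % n
    k≡y%n = sym (begin
      y % n        ≡⟨ %-congˡ (trans (sym n+k≡y) (+-comm n k)) ⟩
      (k + n) % n  ≡⟨ [m+n]%n≡m%n k n ⟩
      k % n        ≡⟨ m<n⇒m%n≡m (≤-trans k<4 (≤-trans (n≤1+n 4) 5≤n)) ⟩
      k            ∎)

  centre-column : Fin n → ℕ
  centre-column c = (toℕ c + (n ∸ 2)) % n

  wrap-centre-column : ∀ c → wrap (2 + centre-column c) ≡ c
  wrap-centre-column c = begin
    wrap (2 + (t + (n ∸ 2)) % n)  ≡⟨ wrap-+% 2 (t + (n ∸ 2)) ⟩
    wrap (2 + (t + (n ∸ 2)))      ≡⟨ cong wrap (trans (x∙yz≈y∙xz 2 t (n ∸ 2)) (cong (t +_) (m+[n∸m]≡n 2≤n))) ⟩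
    wrap (t + n)                  ≡⟨ cong wrap (+-comm t n) ⟩
    wrap (n + t)                  ≡⟨ wrap-periodic t ⟩
    wrap t                        ≡⟨ wrap-toℕ c ⟩
    c                             ∎
    where
    open ≡-Reasoning
    t = toℕ c
    2≤n : 2 ≤ n
    2≤n = ≤-trans (s≤s (s≤s z≤n)) 5≤n

  pattern-isDisjDom : ∀ P → length P ≡ n → T (windows-dominated (map ⟦_⟧ P ++ take 4 (map ⟦_⟧ P))) →
                      IsDisjDom Γ (placements 0 P)
  pattern-isDisjDom P length-P ok (a , c) v∉ = subst (DisjDominated S) centred
    (dominated⇒disjDominated x a (v∉ ∘ subst (_∈ S) centred) marked⇒∈
      (windows-dominated-sound (cs ++ take 4 cs) ok x fits a))
    where
    S = placements 0 P
    cs = map ⟦_⟧ P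
    x = centre-column c
    x<n : x < n
    x<n = m%n<n _ n
    centred : place x (centre a) ≡ (a , c)
    centred = cong (a ,_) (wrap-centre-column c)
    length-cs : length cs ≡ n
    length-cs = trans (length-map ⟦_⟧ P) length-P
    length-ext : length (cs ++ take 4 cs) ≡ n + 4
    length-ext = trans (length-++ cs) (cong₂ _+_ length-cs (trans (length-take 4 cs) (m≤n⇒m⊓n≡m 4≤length)))
      where
      4≤length : 4 ≤ length cs
      4≤length = subst (4 ≤_) (sym length-cs) (≤-trans (n≤1+n 4) 5≤n)
    fits : 5 + x ≤ length (cs ++ take 4 cs)
    fits = subst (5 + x ≤_) (trans (+-comm 4 n) (sym length-ext)) (+-monoʳ-< 4 x<n)
    marked⇒∈ : ∀ {cell} → Marked (window (strip (cs ++ take 4 cs)) x) cell → place x cell ∈ S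
    marked⇒∈ {j , r} r∈ = subst (λ c → (r , c) ∈ S) (wrap-% y)
      (∈-placements 0 P (y % n) (subst (r ∈ₛ_) (strip-wrap-around cs length-cs y y<) r∈))
      where
      y = toℕ j + x
      y< : y < n + 4
      y< = subst (y <_) (+-comm 4 n) (+-mono-≤-< (s≤s⁻¹ (toℕ<n j)) x<n)

  pattern-dominating-set : ∀ P → length P ≡ n → T (windows-dominated (map ⟦_⟧ P ++ take 4 (map ⟦_⟧ P))) →
                           ∃[ S ] (Unique S × IsDisjDom Γ S × length S ≡ length (catMaybes P))
  pattern-dominating-set P length-P ok =
    placements 0 P , placements-unique 0 P (≤-reflexive length-P) , pattern-isDisjDom P length-P ok
                   , length-placements 0 P

HasDisjDomSet : ℕ → ℕ → Set
HasDisjDomSet n k = ∃[ S ] (Unique S × IsDisjDom (Cycle 4 □ Cycle n) S × length S ≡ k)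

four-torus : HasDisjDomSet 4 (target 4)
four-torus = S₄ , from-yes (unique? S₄) , from-yes (isDisjDom? S₄) , refl
  where
  open Torus 4
  open UniqueDec _≟ᵥ_ using (unique?)
  open FiniteGraph Γ _≟ᵥ_
    (λ (a , b) (a′ , b′) → (a Fin.≟ a′ ×-dec cycle-adjacent? 4 b b′)
                         ⊎-dec (b Fin.≟ b′ ×-dec cycle-adjacent? 4 a a′))
    (cartesianProduct (allFin 4) (allFin 4)) (λ (a , b) → ∈-cartesianProduct⁺ (∈-allFin a) (∈-allFin b))
  S₄ : List Vertex
  S₄ = (# 0 , # 0) ∷ (# 2 , # 2) ∷ []

tiled-torus : ∀ q E → T (windows-dominated (map ⟦_⟧ (tile ++ E) ++ map ⟦_⟧ tile)) → 5 ≤ suc q * 4 + length E →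
  suc q * 2 + length (catMaybes E) ≡ target (suc q * 4 + length E) →
  HasDisjDomSet (suc q * 4 + length E) (target (suc q * 4 + length E))
tiled-torus q E ok 5≤n size =
  let S , unique , dds , length-S = pattern-dominating-set (tiles (suc q) ++ E) (length-tiles (suc q) E)
                                                         (subst T (sym (windows-tiles q E)) ok)
  in S , unique , dds , trans length-S (trans (occupied-tiles (suc q) E) size)
  where open Construction (suc q * 4 + length E) 5≤n

upper-bound : ∀ n → 4 ≤ n → HasDisjDomSet n (target n)
upper-bound n 4≤n with residue n
... | 0 , r , r<4 , refl = absurd (<⇒≱ r<4 4≤n)
... | 1 , 0 , _ , refl = four-torus
... | suc (suc q) , 0 , _ , refl = tiled-torus (suc q) [] tt (s≤s (s≤s (s≤s (s≤s (s≤s z≤n)))))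
                                     (trans (+-identityʳ _) (sym (target-0 (suc (suc q)))))
... | suc q , 1 , _ , refl = tiled-torus q (just (# 0) ∷ []) tt (+-monoʳ-≤ 4 (m≤n+m 1 (q * 4)))
                               (trans (+-comm (suc q * 2) 1) (sym (target-1 (suc q))))
... | suc q , 2 , _ , refl = tiled-torus q (just (# 0) ∷ just (# 2) ∷ []) tt
                               (+-monoʳ-≤ 4 (≤-trans (s≤s z≤n) (m≤n+m 2 (q * 4))))
                               (trans (+-comm (suc q * 2) 2) (sym (target-2 (suc q))))
... | suc q , 3 , _ , refl = tiled-torus q (just (# 0) ∷ nothing ∷ just (# 2) ∷ []) tt
                               (+-monoʳ-≤ 4 (≤-trans (s≤s z≤n) (m≤n+m 3 (q * 4))))
                               (trans (+-comm (suc q * 2) 2) (sym (target-3 (suc q))))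
... | _ , suc (suc (suc (suc _))) , s≤s (s≤s (s≤s (s≤s ()))) , _

theorem1p3 : (n : ℕ) → 4 ≤ n → DisjDomNumberIs (Cycle 4 □ Cycle n) (target n)
theorem1p3 n@(suc _) 4≤n = upper-bound n 4≤n , λ S _ dds → Torus.lower-bound n S dds
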